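{- Let $\ell\ge 1$ and let $\lambda=(\lambda_1,\ldots,\lambda_\ell)$ and $\mu=(\mu_1,\ldots,\mu_\ell)$ be non-increasing sequences of non-negative integers (partitions, possibly completed with zeroes so that both have length $\ell$) with the same weight, i.e. $\lambda_1+\cdots+\lambda_\ell=\mu_1+\cdots+\mu_\ell$. Assume that $\lambda$ dominates $\mu$. Then for every positive integer $k$, $\lambda^{(k)}$ dominates $\mu^{(k)}$.
   Context: For non-increasing finite sequences $\lambda,\mu$ of non-negative integers, $\lambda$ dominates $\mu$ (written $\lambda\ge\mu$) if $\lambda_1+\cdots+\lambda_i\ge \mu_1+\cdots+\mu_i$ for all $i$, where $\lambda_i=0$ for $i$ beyond the length of $\lambda$ (and similarly for $\mu$). For an $\ell$-tuple $\lambda=(\lambda_1,\ldots,\lambda_\ell)$ of non-negative integers and an integer $k\ge 0$, $\lambda^{(k)}$ denotes the sequence of length $\ell$ obtained by reordering the values $|\lambda_i-k|$, $1\le i\le \ell$, in non-increasing order. -}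

module Defs where

open import Data.Nat using (ℕ; zero; suc; _≤_; _≤ᵇ_; ∣_-_∣)
open import Data.Bool using (if_then_else_)
open import Data.List using (List; []; _∷_; map; take; length; lookup)
open import Data.Nat.ListAction using (sum)
open import Data.Fin using (Fin; toℕ)

NonIncreasing : List ℕ → Set
NonIncreasing xs = ∀ (i j : Fin (length xs)) → toℕ i ≤ toℕ j → lookup xs j ≤ lookup xs i

-- Dominance: every partial sum of λ is ≥ the corresponding partial sum of μ
-- (take i beyond the length gives the whole list, i.e. padding with zeros).
_⊵_ : List ℕ → List ℕ → Set
lam ⊵ mu = ∀ (i : ℕ) → sum (take i mu) ≤ sum (take i lam)

insertDesc : ℕ → List ℕ → List ℕ
insertDesc x [] = x ∷ []
insertDesc x (y ∷ ys) = if y ≤ᵇ x then x ∷ y ∷ ys else y ∷ insertDesc x ys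

sortDesc : List ℕ → List ℕ
sortDesc [] = []
sortDesc (x ∷ xs) = insertDesc x (sortDesc xs)

-- λ^(k): the values |λ_i - k| reordered in non-increasing order.
shiftK : ℕ → List ℕ → List ℕ
shiftK k lam = sortDesc (map (λ x → ∣ x - k ∣) lam)

-- For a descending list, sum (take i xs) is the minimum over thresholds t of
-- i * t + excess t xs, where excess t xs = Σ (x ∸ t); the minimum is attained at the
-- i-th entry. Hence for descending lists dominance amounts to
-- excess t mu ≤ excess t lam for every t. Now ∣ x - k ∣ ∸ t = (x ∸ (k + t)) + ((k ∸ t) ∸ x),
-- so the excess of a shifted list is an excess of the original plus a deficit
-- Σ (c ∸ x); for lists of equal length and weight the deficit equals
-- length * c + excess c − weight, so it is monotone along with the excess.

module Submission where

open import Defs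
open import Data.Nat using (ℕ; zero; suc; _+_; _*_; _∸_; _≤_; _≥_; _≤ᵇ_; _≤?_; ∣_-_∣; z≤n; s≤s)
open import Data.Nat.Properties
open import Data.Nat.ListAction using (sum)
open import Data.Nat.ListAction.Properties using (sum-↭)
open import Data.List using (List; []; _∷_; length; map; take; lookup)
open import Data.List.Properties using (map-cong; map-∘)
open import Data.List.Relation.Unary.All as All using (All; []; _∷_)
open import Data.List.Relation.Unary.AllPairs using (AllPairs; []; _∷_)
open import Data.List.Relation.Binary.Permutation.Propositional
  using (_↭_; ↭-refl; ↭-prep; ↭-swap; ↭-trans)
open import Data.List.Relation.Binary.Permutation.Propositional.Properties using (map⁺)
open import Data.Bool using (true; false)
open import Data.Fin using (zero; suc)
open import Data.Product using (∃-syntax; _,_)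
open import Data.Sum using (inj₁; inj₂)
open import Relation.Nullary using (yes; no)
open import Relation.Nullary.Reflects using (ofʸ; ofⁿ)
open import Relation.Binary.PropositionalEquality
  using (_≡_; refl; sym; trans; cong; cong₂; module ≡-Reasoning)
open import Algebra.Properties.CommutativeSemigroup +-commutativeSemigroup using (interchange)

excess : ℕ → List ℕ → ℕ
excess t xs = sum (map (_∸ t) xs)

deficit : ℕ → List ℕ → ℕ
deficit c xs = sum (map (c ∸_) xs)

Descending : List ℕ → Set
Descending = AllPairs _≥_

sum-map-+ : ∀ f g (xs : List ℕ) →
  sum (map (λ x → f x + g x) xs) ≡ sum (map f xs) + sum (map g xs)
sum-map-+ f g [] = refl
sum-map-+ f g (x ∷ xs) = begin
  (f x + g x) + sum (map (λ x → f x + g x) xs)    ≡⟨ cong (f x + g x +_) (sum-map-+ f g xs) ⟩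
  (f x + g x) + (sum (map f xs) + sum (map g xs)) ≡⟨ interchange (f x) (g x) _ _ ⟩
  (f x + sum (map f xs)) + (g x + sum (map g xs)) ∎
  where open ≡-Reasoning

insertDesc-↭ : ∀ x ys → insertDesc x ys ↭ x ∷ ys
insertDesc-↭ x [] = ↭-refl
insertDesc-↭ x (y ∷ ys) with y ≤ᵇ x
... | true  = ↭-refl
... | false = ↭-trans (↭-prep y (insertDesc-↭ x ys)) (↭-swap y x ↭-refl)

sortDesc-↭ : ∀ xs → sortDesc xs ↭ xs
sortDesc-↭ []       = ↭-refl
sortDesc-↭ (x ∷ xs) = ↭-trans (insertDesc-↭ x (sortDesc xs)) (↭-prep x (sortDesc-↭ xs))

insertDesc-bounded : ∀ {z} x ys → x ≤ z → All (_≤ z) ys → All (_≤ z) (insertDesc x ys)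
insertDesc-bounded x []       x≤z []          = x≤z ∷ []
insertDesc-bounded x (y ∷ ys) x≤z (y≤z ∷ ys≤z) with y ≤ᵇ x
... | true  = x≤z ∷ y≤z ∷ ys≤z
... | false = y≤z ∷ insertDesc-bounded x ys x≤z ys≤z

insertDesc-descending : ∀ x ys → Descending ys → Descending (insertDesc x ys)
insertDesc-descending x []       []           = [] ∷ []
insertDesc-descending x (y ∷ ys) (y≥ys ∷ ys↓) with y ≤ᵇ x | ≤ᵇ-reflects-≤ y x
... | true  | ofʸ y≤x = (y≤x ∷ All.map (λ z≤y → ≤-trans z≤y y≤x) y≥ys) ∷ y≥ys ∷ ys↓
... | false | ofⁿ y≰x =
  insertDesc-bounded x ys (≰⇒≥ y≰x) y≥ys ∷ insertDesc-descending x ys ys↓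

sortDesc-descending : ∀ xs → Descending (sortDesc xs)
sortDesc-descending []       = []
sortDesc-descending (x ∷ xs) = insertDesc-descending x (sortDesc xs) (sortDesc-descending xs)

all-lookup : ∀ {P : ℕ → Set} xs → (∀ j → P (lookup xs j)) → All P xs
all-lookup []       _ = []
all-lookup (x ∷ xs) p = p zero ∷ all-lookup xs (λ j → p (suc j))

nonIncreasing⇒descending : ∀ xs → NonIncreasing xs → Descending xs
nonIncreasing⇒descending []       _     = []
nonIncreasing⇒descending (x ∷ xs) x∷xs↓ =
  all-lookup xs (λ j → x∷xs↓ zero (suc j) z≤n)
  ∷ nonIncreasing⇒descending xs (λ i j i≤j → x∷xs↓ (suc i) (suc j) (s≤s i≤j))

excess-↭ : ∀ t {xs ys} → xs ↭ ys → excess t xs ≡ excess t ys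
excess-↭ t p = sum-↭ (map⁺ (_∸ t) p)

excess-bounded : ∀ {t} xs → All (_≤ t) xs → excess t xs ≡ 0
excess-bounded []       []           = refl
excess-bounded (x ∷ xs) (x≤t ∷ xs≤t) rewrite m≤n⇒m∸n≡0 x≤t = excess-bounded xs xs≤t

sum-take≤ : ∀ t i xs → sum (take i xs) ≤ i * t + excess t xs
sum-take≤ t zero    xs       = z≤n
sum-take≤ t (suc i) []       = z≤n
sum-take≤ t (suc i) (x ∷ xs) = begin
  x + sum (take i xs)                      ≤⟨ +-mono-≤ (m≤n+m∸n x t) (sum-take≤ t i xs) ⟩
  (t + (x ∸ t)) + (i * t + excess t xs)    ≡⟨ interchange t (x ∸ t) (i * t) (excess t xs) ⟩
  (t + i * t) + ((x ∸ t) + excess t xs)    ∎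
  where open ≤-Reasoning

sum-take≥-cons : ∀ {t x i} xs → t ≤ x → i * t + excess t xs ≤ sum (take i xs) →
  suc i * t + excess t (x ∷ xs) ≤ sum (take (suc i) (x ∷ xs))
sum-take≥-cons {t} {x} {i} xs t≤x bound = begin
  (t + i * t) + ((x ∸ t) + excess t xs)  ≡⟨ interchange t (i * t) (x ∸ t) (excess t xs) ⟩
  (t + (x ∸ t)) + (i * t + excess t xs)  ≡⟨ cong (_+ (i * t + excess t xs)) (m+[n∸m]≡n t≤x) ⟩
  x + (i * t + excess t xs)              ≤⟨ +-monoʳ-≤ x bound ⟩
  x + sum (take i xs)                    ∎
  where open ≤-Reasoning

sum-take≥-some : ∀ t xs → Descending xs → ∃[ i ] i * t + excess t xs ≤ sum (take i xs)
sum-take≥-some t []       []           = 0 , z≤n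
sum-take≥-some t (x ∷ xs) (x≥xs ∷ xs↓) with x ≤? t
... | yes x≤t = 0 , ≤-reflexive (excess-bounded (x ∷ xs) (x≤t ∷ All.map (λ y≤x → ≤-trans y≤x x≤t) x≥xs))
... | no  x≰t with sum-take≥-some t xs xs↓
...   | i , bound = suc i , sum-take≥-cons {i = i} xs (≰⇒≥ x≰t) bound

-- The entry of index i (counting from 0), with junk value 0 past the end.
entry : List ℕ → ℕ → ℕ
entry []       _       = 0
entry (x ∷ xs) zero    = x
entry (x ∷ xs) (suc i) = entry xs i

entry-bounded : ∀ {z} xs i → All (_≤ z) xs → entry xs i ≤ z
entry-bounded []       i       []         = z≤n
entry-bounded (x ∷ xs) zero    (x≤z ∷ _)  = x≤z
entry-bounded (x ∷ xs) (suc i) (_ ∷ xs≤z) = entry-bounded xs i xs≤z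

sum-take≥-entry : ∀ xs → Descending xs → ∀ i →
  i * entry xs i + excess (entry xs i) xs ≤ sum (take i xs)
sum-take≥-entry []       []           i rewrite *-zeroʳ i = z≤n
sum-take≥-entry (x ∷ xs) (x≥xs ∷ xs↓) zero
  rewrite n∸n≡0 x | excess-bounded xs x≥xs = z≤n
sum-take≥-entry (x ∷ xs) (x≥xs ∷ xs↓) (suc i) =
  sum-take≥-cons {i = i} xs (entry-bounded xs i x≥xs) (sum-take≥-entry xs xs↓ i)

⊵⇒excess-≤ : ∀ lam mu → Descending mu → lam ⊵ mu → ∀ t → excess t mu ≤ excess t lam
⊵⇒excess-≤ lam mu mu↓ lam⊵mu t with sum-take≥-some t mu mu↓
... | i , bound = +-cancelˡ-≤ (i * t) _ _ (begin
  i * t + excess t mu  ≤⟨ bound ⟩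
  sum (take i mu)      ≤⟨ lam⊵mu i ⟩
  sum (take i lam)     ≤⟨ sum-take≤ t i lam ⟩
  i * t + excess t lam ∎)
  where open ≤-Reasoning

excess-≤⇒⊵ : ∀ lam mu → Descending lam → (∀ t → excess t mu ≤ excess t lam) → lam ⊵ mu
excess-≤⇒⊵ lam mu lam↓ excess≤ i = begin
  sum (take i mu)       ≤⟨ sum-take≤ t i mu ⟩
  i * t + excess t mu   ≤⟨ +-monoʳ-≤ (i * t) (excess≤ t) ⟩
  i * t + excess t lam  ≤⟨ sum-take≥-entry lam lam↓ i ⟩
  sum (take i lam)      ∎
  where
  open ≤-Reasoning
  t = entry lam i

[m∸n]+n≡m+[n∸m] : ∀ m n → (m ∸ n) + n ≡ m + (n ∸ m)
[m∸n]+n≡m+[n∸m] m n with ≤-total m n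
... | inj₁ m≤n rewrite m≤n⇒m∸n≡0 m≤n = sym (m+[n∸m]≡n m≤n)
... | inj₂ n≤m rewrite m≤n⇒m∸n≡0 n≤m = trans (m∸n+n≡m n≤m) (sym (+-identityʳ m))

deficit+sum≡ : ∀ c xs → deficit c xs + sum xs ≡ length xs * c + excess c xs
deficit+sum≡ c []       = refl
deficit+sum≡ c (x ∷ xs) = begin
  ((c ∸ x) + deficit c xs) + (x + sum xs)       ≡⟨ interchange (c ∸ x) (deficit c xs) x (sum xs) ⟩
  ((c ∸ x) + x) + (deficit c xs + sum xs)       ≡⟨ cong₂ _+_ ([m∸n]+n≡m+[n∸m] c x) (deficit+sum≡ c xs) ⟩
  (c + (x ∸ c)) + (length xs * c + excess c xs) ≡⟨ interchange c (x ∸ c) (length xs * c) (excess c xs) ⟩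
  (c + length xs * c) + ((x ∸ c) + excess c xs) ∎
  where open ≡-Reasoning

deficit-mono : ∀ c lam mu → length lam ≡ length mu → sum lam ≡ sum mu →
  excess c mu ≤ excess c lam → deficit c mu ≤ deficit c lam
deficit-mono c lam mu len≡ sum≡ excess≤ = +-cancelʳ-≤ (sum mu) _ _ (begin
  deficit c mu + sum mu          ≡⟨ deficit+sum≡ c mu ⟩
  length mu * c + excess c mu    ≤⟨ +-monoʳ-≤ (length mu * c) excess≤ ⟩
  length mu * c + excess c lam   ≡⟨ cong (λ n → n * c + excess c lam) len≡ ⟨
  length lam * c + excess c lam  ≡⟨ deficit+sum≡ c lam ⟨
  deficit c lam + sum lam        ≡⟨ cong (deficit c lam +_) sum≡ ⟩
  deficit c lam + sum mu         ∎)
  where open ≤-Reasoning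

∣x-k∣∸t≡ : ∀ k t x → ∣ x - k ∣ ∸ t ≡ (x ∸ (k + t)) + ((k ∸ t) ∸ x)
∣x-k∣∸t≡ k t x with ≤-total x k
... | inj₁ x≤k rewrite m≤n⇒∣m-n∣≡n∸m x≤k | m≤n⇒m∸n≡0 (≤-trans x≤k (m≤m+n k t)) = begin
  k ∸ x ∸ t   ≡⟨ ∸-+-assoc k x t ⟩
  k ∸ (x + t) ≡⟨ cong (k ∸_) (+-comm x t) ⟩
  k ∸ (t + x) ≡⟨ ∸-+-assoc k t x ⟨
  k ∸ t ∸ x   ∎
  where open ≡-Reasoning
... | inj₂ k≤x rewrite m≤n⇒∣n-m∣≡n∸m k≤x | m≤n⇒m∸n≡0 (≤-trans (m∸n≤m k t) k≤x) =
  trans (∸-+-assoc x k t) (sym (+-identityʳ _))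

shiftK-descending : ∀ k xs → Descending (shiftK k xs)
shiftK-descending k xs = sortDesc-descending (map (λ x → ∣ x - k ∣) xs)

excess-shiftK : ∀ k t xs → excess t (shiftK k xs) ≡ excess (k + t) xs + deficit (k ∸ t) xs
excess-shiftK k t xs = begin
  excess t (shiftK k xs)
    ≡⟨ excess-↭ t (sortDesc-↭ (map (λ x → ∣ x - k ∣) xs)) ⟩
  sum (map (_∸ t) (map (λ x → ∣ x - k ∣) xs))
    ≡⟨ cong sum (map-∘ xs) ⟨
  sum (map (λ x → ∣ x - k ∣ ∸ t) xs)
    ≡⟨ cong sum (map-cong (∣x-k∣∸t≡ k t) xs) ⟩
  sum (map (λ x → (x ∸ (k + t)) + ((k ∸ t) ∸ x)) xs)
    ≡⟨ sum-map-+ (_∸ (k + t)) ((k ∸ t) ∸_) xs ⟩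
  excess (k + t) xs + deficit (k ∸ t) xs
    ∎
  where open ≡-Reasoning

mainTheorem1 : (ℓ : ℕ) → 1 ≤ ℓ → (lam mu : List ℕ) →
    length lam ≡ ℓ → length mu ≡ ℓ →
    NonIncreasing lam → NonIncreasing mu →
    sum lam ≡ sum mu → lam ⊵ mu →
    (k : ℕ) → 1 ≤ k → shiftK k lam ⊵ shiftK k mu
mainTheorem1 _ _ lam mu len-lam len-mu _ mu↓ sum≡ lam⊵mu k _ =
  excess-≤⇒⊵ (shiftK k lam) (shiftK k mu) (shiftK-descending k lam) λ t → begin
    excess t (shiftK k mu)                     ≡⟨ excess-shiftK k t mu ⟩
    excess (k + t) mu + deficit (k ∸ t) mu     ≤⟨ +-mono-≤ (excess≤ (k + t)) deficit≤ ⟩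
    excess (k + t) lam + deficit (k ∸ t) lam   ≡⟨ excess-shiftK k t lam ⟨
    excess t (shiftK k lam)                    ∎
  where
  open ≤-Reasoning
  excess≤ : ∀ c → excess c mu ≤ excess c lam
  excess≤ = ⊵⇒excess-≤ lam mu (nonIncreasing⇒descending mu mu↓) lam⊵mu
  deficit≤ : ∀ {c} → deficit c mu ≤ deficit c lam
  deficit≤ {c} = deficit-mono c lam mu (trans len-lam (sym len-mu)) sum≡ (excess≤ c)
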